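{- Let $k \geq 1$ be an integer and let $(G,\Sigma)$ be a signed graph with frustration index $l(G,\Sigma)=k$. Then for every $m \in \{1,\dots,k\}$, $(G,\Sigma)$ contains a subgraph which is $m$-critical.
   Context: A signed graph $(G,\Sigma)$ is a finite graph $G$ (loops and multiple edges allowed) together with a set $\Sigma \subseteq E(G)$ of negative edges; all other edges are positive. A circuit (a loop is a circuit of length 1, two parallel edges form a circuit of length 2) is negative if it contains an odd number of edges of $\Sigma$. $(G,\Sigma)$ is balanced if it contains no negative circuit. The frustration index $l(G,\Sigma)$ is the minimum cardinality of a set $E \subseteq E(G)$ such that $(G-E,\Sigma-E)$ is balanced; $(G,\Sigma)$ is $k$-frustrated if $l(G,\Sigma)=k$. For an integer $k\ge 1$, $(G,\Sigma)$ is $k$-critical if it is $k$-frustrated and $l(G-e,\Sigma-\{e\})<k$ for every edge $e\in E(G)$. A subgraph of $(G,\Sigma)$ is a signed graph $(H,\Sigma\cap E(H))$ where $H$ is a subgraph of $G$. -}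

module Defs where

open import Data.Nat using (ℕ; zero; suc; _<_; _≤_; _%_; _<?_; s≤s)
open import Data.Fin using (Fin; zero; suc; toℕ; fromℕ<)
open import Data.Fin.Subset using (Subset; _∈_; _∉_; _⊆_; _─_; ⁅_⁆; ∣_∣; inside; outside)
open import Data.Vec using (lookup)
open import Data.List using (List; map; allFin)
open import Data.Nat.ListAction using (sum)
open import Data.Product using (Σ; _×_; _,_; ∃; ∃-syntax)
open import Data.Sum using (_⊎_)
open import Relation.Nullary using (¬_; yes; no)
open import Relation.Binary.PropositionalEquality using (_≡_)
open import Function.Definitions using (Injective)

-- A finite signed graph (loops and multiple edges allowed):
-- vertices Fin V, edges Fin E, each edge has two (possibly equal) ends,
-- and Σ ⊆ E(G) is the set of negative edges.
record SignedGraph : Set where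
  field
    V    : ℕ
    E    : ℕ
    ends : Fin E → Fin V × Fin V
    Sig  : Subset E
open SignedGraph public

Joins : (G : SignedGraph) → Fin (E G) → Fin (V G) → Fin (V G) → Set
Joins G e u v = (ends G e ≡ (u , v)) ⊎ (ends G e ≡ (v , u))

next : ∀ {n} → Fin (suc n) → Fin (suc n)
next {n} i with suc (toℕ i) <? suc n
... | yes p = fromℕ< p
... | no _  = zero

-- Length 1 = loop, length 2 = two parallel edges.
record Circuit (G : SignedGraph) (A : Subset (E G)) : Set where
  field
    len    : ℕ
    edge   : Fin (suc len) → Fin (E G)
    vert   : Fin (suc len) → Fin (V G)
    edgeInj : Injective _≡_ _≡_ edge
    vertInj : Injective _≡_ _≡_ vert
    joins  : ∀ i → Joins G (edge i) (vert i) (vert (next i))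
    inA    : ∀ i → edge i ∈ A
open Circuit public

negCount : {G : SignedGraph} {A : Subset (E G)} → Circuit G A → ℕ
negCount {G} C = sum (map f (allFin (suc (len C))))
  where
  f : Fin (suc (len C)) → ℕ
  f i with lookup (Sig G) (edge C i)
  ... | inside  = 1
  ... | outside = 0

NegativeCircuit : {G : SignedGraph} {A : Subset (E G)} → Circuit G A → Set
NegativeCircuit C = negCount C % 2 ≡ 1

Balanced : (G : SignedGraph) → Subset (E G) → Set
Balanced G A = ¬ (Σ (Circuit G A) NegativeCircuit)

Frustrated : (G : SignedGraph) → Subset (E G) → ℕ → Set
Frustrated G A k =
  (∃[ D ] (D ⊆ A × ∣ D ∣ ≡ k × Balanced G (A ─ D))) ×
  (∀ D → D ⊆ A → Balanced G (A ─ D) → k ≤ ∣ D ∣)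

Critical : (G : SignedGraph) → Subset (E G) → ℕ → Set
Critical G A k =
  Frustrated G A k ×
  (∀ e → e ∈ A → ∃[ j ] (j < k × Frustrated G (A ─ ⁅ e ⁆) j))

record Subgraph (G : SignedGraph) : Set where
  field
    W       : Subset (V G)
    A       : Subset (E G)
    closed  : ∀ e → e ∈ A → (Data.Product.proj₁ (ends G e) ∈ W) × (Data.Product.proj₂ (ends G e) ∈ W)
open Subgraph public

allEdges : (G : SignedGraph) → Subset (E G)
allEdges G = Data.Fin.Subset.⊤

{-# OPTIONS --safe #-}
module Submission where

-- Balance is decidable by an exhaustive search for negative circuits (a circuit has distinct
-- vertices, so there are finitely many), hence every edge set A has a frustration index l(A).
-- Deleting an edge e lowers it by at most one: a balancing set of A - e plus e balances A.
-- Now take an edge set B of least size with l(B) ≥ m; one exists because l(E(G)) = k ≥ m.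
-- For every e ∈ B minimality gives l(B - e) < m ≤ l(B) ≤ l(B - e) + 1, so l(B) = m and B is
-- m-critical.

open import Defs
open import Data.Nat using (ℕ; _≤_)
open import Data.Product using (_×_; ∃-syntax)

open import Level using (Level)
open import Data.Nat using (zero; suc; _<_; _+_; _%_; z≤n; s≤s; _≤?_)
open import Data.Nat.Properties
  using (≤-trans; ≤-reflexive; ≤-antisym; ≮⇒≥; ≰⇒>; <⇒≱; >⇒≢; +-suc; n≤1+n; +-monoʳ-≤; module ≤-Reasoning)
  renaming (_≟_ to _≟ℕ_)
open import Data.Fin using (Fin; zero; suc; toℕ; fromℕ; fromℕ<; inject)
open import Data.Fin.Properties
  using (any?; all?; ¬∀⟶∃¬-smallest; toℕ-fromℕ; toℕ-fromℕ<; toℕ-inject; injective⇒≤)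
  renaming (_≟_ to _≟Fin_)
open import Data.Fin.Subset using (Subset; Side; inside; outside; _∈_; _⊆_; _─_; _-_; ⁅_⁆; ∣_∣; _∪_; Nonempty; ⊤)
open import Data.Fin.Subset.Properties
  using (_∈?_; _⊆?_; anySubset?; nonempty?; Empty-unique; ∣⊥∣≡0; ∈⊤; ∣⁅x⁆∣≡1; x∈p∪q⁻; x∈⁅y⁆⇒x≡y;
         p─q⊆p; p─q─r≡p─q∪r; x∈p⇒∣p-x∣<∣p∣)
open import Data.Vec using (lookup; []; _∷_; there)
open import Data.Vec.Functional using (head; tail) renaming (_∷_ to _◂_)
open import Data.Vec.Functional.Properties using (∷-cong)
open import Data.List using (map; allFin)
open import Data.List.Properties using (map-cong)
open import Data.Nat.ListAction using (sum)
open import Data.Product using (Σ; _,_; proj₁; proj₂; ∃)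
open import Data.Product.Properties using (≡-dec)
open import Data.Sum using (inj₁; inj₂)
open import Function using (id; _∘_)
open import Function.Definitions using (Injective)
open import Relation.Nullary using (¬_; Dec)
open import Relation.Nullary.Decidable using (map′; _×-dec_; _⊎-dec_; _→-dec_; ¬?; decidable-stable)
open import Relation.Unary using (Pred; Decidable)
open import Relation.Binary.PropositionalEquality

private
  variable
    ℓ : Level
    m n : ℕ

least : {P : Pred ℕ ℓ} → Decidable P → P n → ∃ λ j → P j × (∀ {i} → P i → j ≤ i)
least {n = n} {P = P} P? pn
  with ¬∀⟶∃¬-smallest (suc n) (¬_ ∘ P ∘ toℕ) (¬? ∘ P? ∘ toℕ)
         (λ none → none (fromℕ n) (subst P (sym (toℕ-fromℕ n)) pn))
... | j , ¬¬Pj , below = toℕ j , decidable-stable (P? (toℕ j)) ¬¬Pj , minimal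
  where
  minimal : ∀ {i} → P i → toℕ j ≤ i
  minimal {i} pi = ≮⇒≥ λ i<j →
    below (fromℕ< i<j) (subst P (sym (trans (toℕ-inject (fromℕ< i<j)) (toℕ-fromℕ< i<j))) pi)

smallestSubset : {P : Pred (Subset n) ℓ} → Decidable P → ∃ P →
                 ∃ λ D → P D × (∀ {D′} → P D′ → ∣ D ∣ ≤ ∣ D′ ∣)
smallestSubset P? (D , pD)
  with least (λ s → anySubset? (λ D → P? D ×-dec (∣ D ∣ ≟ℕ s))) (D , pD , refl)
... | _ , (D₀ , pD₀ , refl) , minimal = D₀ , pD₀ , λ {D′} pD′ → minimal (D′ , pD′ , refl)

anyFunction? : ∀ n {P : Pred (Fin n → Fin m) ℓ} →
               (∀ {f g} → f ≗ g → P f → P g) → Decidable P → Dec (∃ P)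
anyFunction? zero resp P? = map′ (_ ,_) (λ (f , pf) → resp (λ ()) pf) (P? (λ ()))
anyFunction? (suc n) resp P? =
  map′ (λ (b , f , pf) → b ◂ f , pf)
       (λ (f , pf) → head f , tail f , resp (∷-cong refl λ _ → refl) pf)
       (any? λ b → anyFunction? n (λ f≗g → resp (∷-cong refl f≗g)) (P? ∘ (b ◂_)))

injective? : (f : Fin m → Fin n) → Dec (Injective _≡_ _≡_ f)
injective? f = map′ (λ inj {x} {y} → inj x y) (λ inj x y → inj)
                    (all? λ x → all? λ y → (f x ≟Fin f y) →-dec (x ≟Fin y))

Injective-resp : {f g : Fin m → Fin n} → f ≗ g → Injective _≡_ _≡_ f → Injective _≡_ _≡_ g
Injective-resp {f = f} {g} f≗g inj {x} {y} gx≡gy = inj (begin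
  f x ≡⟨ f≗g x ⟩ g x ≡⟨ gx≡gy ⟩ g y ≡⟨ f≗g y ⟨ f y ∎)
  where open ≡-Reasoning

x∉p─p : ∀ {x : Fin n} (p : Subset n) → ¬ x ∈ p ─ p
x∉p─p {x = zero}  (inside  ∷ p) ()
x∉p─p {x = zero}  (outside ∷ p) ()
x∉p─p {x = suc x} (inside  ∷ p) (there x∈) = x∉p─p p x∈
x∉p─p {x = suc x} (outside ∷ p) (there x∈) = x∉p─p p x∈

∣p∪q∣≤∣p∣+∣q∣ : ∀ (p q : Subset n) → ∣ p ∪ q ∣ ≤ ∣ p ∣ + ∣ q ∣
∣p∪q∣≤∣p∣+∣q∣ []            []            = z≤n
∣p∪q∣≤∣p∣+∣q∣ (inside  ∷ p) (inside  ∷ q) = s≤s (≤-trans (∣p∪q∣≤∣p∣+∣q∣ p q) (+-monoʳ-≤ ∣ p ∣ (n≤1+n ∣ q ∣)))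
∣p∪q∣≤∣p∣+∣q∣ (inside  ∷ p) (outside ∷ q) = s≤s (∣p∪q∣≤∣p∣+∣q∣ p q)
∣p∪q∣≤∣p∣+∣q∣ (outside ∷ p) (inside  ∷ q) = ≤-trans (s≤s (∣p∪q∣≤∣p∣+∣q∣ p q)) (≤-reflexive (sym (+-suc ∣ p ∣ ∣ q ∣)))
∣p∪q∣≤∣p∣+∣q∣ (outside ∷ p) (outside ∷ q) = ∣p∪q∣≤∣p∣+∣q∣ p q

0<∣p∣⇒Nonempty : (p : Subset n) → 0 < ∣ p ∣ → Nonempty p
0<∣p∣⇒Nonempty {n} p 0<∣p∣ = decidable-stable (nonempty? p) λ empty →
  >⇒≢ 0<∣p∣ (trans (cong ∣_∣ (Empty-unique empty)) (∣⊥∣≡0 n))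

insideCount : Side → ℕ
insideCount inside  = 1
insideCount outside = 0

negativeEdges : (G : SignedGraph) → (Fin n → Fin (E G)) → ℕ
negativeEdges {n} G es = sum (map (insideCount ∘ lookup (Sig G) ∘ es) (allFin n))

summandOf : (s : ℕ) {f : Fin n → ℕ} → s ≡ sum (map f (allFin n)) → Fin n → ℕ
summandOf _ {f} _ = f

-- The summand of `negCount` is `where`-bound in Defs, so it can only be named through unification.
negCountSummand : ∀ {G A} (C : Circuit G A) → Fin (suc (len C)) → ℕ
negCountSummand C = summandOf (negCount C) refl

negCount≡negativeEdges : ∀ {G A} (C : Circuit G A) → negCount C ≡ negativeEdges G (edge C)
negCount≡negativeEdges {G} C = cong sum (map-cong summand≗ (allFin _))
  where
  summand≗ : ∀ i → negCountSummand C i ≡ insideCount (lookup (Sig G) (edge C i))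
  summand≗ i with lookup (Sig G) (edge C i)
  ... | inside  = refl
  ... | outside = refl

module _ (G : SignedGraph) (A : Subset (E G)) where

  NegativeCircuitOn : ∀ ℓ → (Fin (suc ℓ) → Fin (E G)) → (Fin (suc ℓ) → Fin (V G)) → Set
  NegativeCircuitOn ℓ es vs =
    Injective _≡_ _≡_ es × Injective _≡_ _≡_ vs ×
    (∀ i → Joins G (es i) (vs i) (vs (next i))) × (∀ i → es i ∈ A) × negativeEdges G es % 2 ≡ 1

  negativeCircuitOn? : ∀ ℓ es vs → Dec (NegativeCircuitOn ℓ es vs)
  negativeCircuitOn? ℓ es vs =
    injective? es ×-dec injective? vs ×-dec
    all? (λ i → ends G (es i) ≟ends (vs i , vs (next i)) ⊎-dec ends G (es i) ≟ends (vs (next i) , vs i)) ×-dec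
    all? (λ i → es i ∈? A) ×-dec
    (negativeEdges G es % 2 ≟ℕ 1)
    where
    _≟ends_ : (x y : Fin (V G) × Fin (V G)) → Dec (x ≡ y)
    _≟ends_ = ≡-dec _≟Fin_ _≟Fin_

  NegativeCircuitOn-resp : ∀ {ℓ es es′ vs vs′} → es ≗ es′ → vs ≗ vs′ →
                           NegativeCircuitOn ℓ es vs → NegativeCircuitOn ℓ es′ vs′
  NegativeCircuitOn-resp {es = es} {es′} {vs} {vs′} es≗ vs≗ (es-inj , vs-inj , joins , inA , odd) =
    Injective-resp es≗ es-inj , Injective-resp vs≗ vs-inj ,
    (λ i → subst₂ (λ e u → Joins G e u (vs′ (next i))) (es≗ i) (vs≗ i)
             (subst (Joins G (es i) (vs i)) (vs≗ (next i)) (joins i))) ,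
    (λ i → subst (_∈ A) (es≗ i) (inA i)) ,
    subst (λ c → c % 2 ≡ 1) (cong sum (map-cong (cong (insideCount ∘ lookup (Sig G)) ∘ es≗) (allFin _))) odd

  HasNegativeCircuitOfLength : ℕ → Set
  HasNegativeCircuitOfLength ℓ = ∃ λ es → ∃ λ vs → NegativeCircuitOn ℓ es vs

  hasNegativeCircuitOfLength? : ∀ ℓ → Dec (HasNegativeCircuitOfLength ℓ)
  hasNegativeCircuitOfLength? ℓ =
    anyFunction? (suc ℓ) (λ es≗ (vs , c) → vs , NegativeCircuitOn-resp es≗ (λ _ → refl) c) λ es →
    anyFunction? (suc ℓ) (NegativeCircuitOn-resp (λ _ → refl)) (negativeCircuitOn? ℓ es)

  negativeCircuit? : Dec (Σ (Circuit G A) NegativeCircuit)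
  negativeCircuit? = map′ toCircuit fromCircuit (any? (hasNegativeCircuitOfLength? ∘ toℕ))
    where
    toCircuit : ∃ (HasNegativeCircuitOfLength ∘ toℕ {V G}) → Σ (Circuit G A) NegativeCircuit
    toCircuit (ℓ , es , vs , es-inj , vs-inj , joins , inA , odd) =
      C , subst (λ c → c % 2 ≡ 1) (sym (negCount≡negativeEdges C)) odd
      where
      C : Circuit G A
      C = record { len = toℕ ℓ ; edge = es ; vert = vs ; edgeInj = es-inj ; vertInj = vs-inj
                 ; joins = joins ; inA = inA }
    fromCircuit : Σ (Circuit G A) NegativeCircuit → ∃ (HasNegativeCircuitOfLength ∘ toℕ {V G})
    fromCircuit (C , neg) = fromℕ< len<V ,
      subst HasNegativeCircuitOfLength (sym (toℕ-fromℕ< len<V))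
        (edge C , vert C , edgeInj C , vertInj C , joins C , inA C ,
         subst (λ c → c % 2 ≡ 1) (negCount≡negativeEdges C) neg)
      where
      len<V : len C < V G
      len<V = injective⇒≤ (vertInj C)

  balanced? : Dec (Balanced G A)
  balanced? = ¬? negativeCircuit?

Balanced-A─A : ∀ G (A : Subset (E G)) → Balanced G (A ─ A)
Balanced-A─A G A (C , _) = x∉p─p A (inA C zero)

-- `abstract` keeps type checking from unfolding the exhaustive search.
abstract
  frustration : ∀ G (A : Subset (E G)) → ∃ (Frustrated G A)
  frustration G A with smallestSubset (λ D → D ⊆? A ×-dec balanced? G (A ─ D)) (A , id , Balanced-A─A G A)
  ... | D , (D⊆A , balanced) , minimal =
    ∣ D ∣ , (D , D⊆A , refl , balanced) , λ D′ D′⊆A balanced′ → minimal (D′⊆A , balanced′)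

frustrationIndex : ∀ G → Subset (E G) → ℕ
frustrationIndex G A = proj₁ (frustration G A)

frustrated : ∀ G (A : Subset (E G)) → Frustrated G A (frustrationIndex G A)
frustrated G A = proj₂ (frustration G A)

Frustrated-unique : ∀ {G A j j′} → Frustrated G A j → Frustrated G A j′ → j ≡ j′
Frustrated-unique ((D , D⊆A , refl , bal) , minimal) ((D′ , D′⊆A , refl , bal′) , minimal′) =
  ≤-antisym (minimal D′ D′⊆A bal′) (minimal′ D D⊆A bal)

Frustrated⇒≤∣A∣ : ∀ {G A j} → Frustrated G A j → j ≤ ∣ A ∣
Frustrated⇒≤∣A∣ {G} {A} (_ , minimal) = minimal A id (Balanced-A─A G A)

Frustrated-delete : ∀ {G A j j′} e → e ∈ A → Frustrated G A j → Frustrated G (A - e) j′ → j ≤ suc j′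
Frustrated-delete {G} {A} {j} {j′} e e∈A (_ , minimal) ((D′ , D′⊆A-e , refl , balanced′) , _) = begin
  j                   ≤⟨ minimal (⁅ e ⁆ ∪ D′) D⊆A (subst (Balanced G) (p─q─r≡p─q∪r A ⁅ e ⁆ D′) balanced′) ⟩
  ∣ ⁅ e ⁆ ∪ D′ ∣      ≤⟨ ∣p∪q∣≤∣p∣+∣q∣ ⁅ e ⁆ D′ ⟩
  ∣ ⁅ e ⁆ ∣ + ∣ D′ ∣  ≡⟨ cong (_+ ∣ D′ ∣) (∣⁅x⁆∣≡1 e) ⟩
  suc ∣ D′ ∣          ∎
  where
  open ≤-Reasoning
  D⊆A : ⁅ e ⁆ ∪ D′ ⊆ A
  D⊆A x∈ with x∈p∪q⁻ ⁅ e ⁆ D′ x∈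
  ... | inj₁ x∈⁅e⁆ = subst (_∈ A) (sym (x∈⁅y⁆⇒x≡y e x∈⁅e⁆)) e∈A
  ... | inj₂ x∈D′  = p─q⊆p A ⁅ e ⁆ (D′⊆A-e x∈D′)

smallest⇒Critical : ∀ G {m} (B : Subset (E G)) → 1 ≤ m → m ≤ frustrationIndex G B →
                    (∀ {B′} → m ≤ frustrationIndex G B′ → ∣ B ∣ ≤ ∣ B′ ∣) → Critical G B m
smallest⇒Critical G {m} B 1≤m m≤lB minimal =
  subst (Frustrated G B) lB≡m (frustrated G B) ,
  λ e e∈B → frustrationIndex G (B - e) , deletion< e e∈B , frustrated G (B - e)
  where
  deletion< : ∀ e → e ∈ B → frustrationIndex G (B - e) < m
  deletion< e e∈B = ≰⇒> λ m≤ → <⇒≱ (x∈p⇒∣p-x∣<∣p∣ e∈B) (minimal m≤)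
  nonempty : Nonempty B
  nonempty = 0<∣p∣⇒Nonempty B (≤-trans 1≤m (≤-trans m≤lB (Frustrated⇒≤∣A∣ (frustrated G B))))
  lB≡m : frustrationIndex G B ≡ m
  lB≡m with nonempty
  ... | e , e∈B = ≤-antisym
    (≤-trans (Frustrated-delete e e∈B (frustrated G B) (frustrated G (B - e)))
             (deletion< e e∈B))
    m≤lB

proposition2p1 : (k : ℕ) → 1 ≤ k → (G : SignedGraph) → Frustrated G (allEdges G) k →
    (m : ℕ) → 1 ≤ m → m ≤ k → ∃[ H ] Critical G (Subgraph.A {G} H) m
proposition2p1 k _ G Fk m 1≤m m≤k
  with smallestSubset (λ B → m ≤? frustrationIndex G B) (⊤ , m≤l⊤)
  where
  m≤l⊤ : m ≤ frustrationIndex G ⊤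
  m≤l⊤ = subst (m ≤_) (Frustrated-unique Fk (frustrated G ⊤)) m≤k
... | B , m≤lB , minimal =
  record { W = ⊤ ; A = B ; closed = λ _ _ → ∈⊤ , ∈⊤ } , smallest⇒Critical G B 1≤m m≤lB minimal
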